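{- Let $n\ge5$ be an integer such that $n-1$ is not divisible by $3$. Then every spanning subgraph $G\subseteq K_n^+\subseteq\overline{\mathcal K}_n^{(1)}$ which is isomorphic (as a graph) to $(CH)^{(1)}$ for some Hamiltonian graph $H$ is a bypassing subgraph in $\overline{\mathcal K}_n$ and is $1$-ic-colorable in $\overline{\mathcal K}_n$.
   Context: The simplicial poset $\overline{\mathcal K}_n$: a minimum $\hat0$; vertices $v_1,\dots,v_n$; edges $e_{ij}=e_{ji}$ and $e^i_j=e^j_i$ for each pair $i\ne j$, both with endpoints $v_i,v_j$; triangles $\Delta_{ijk}$ (one for each $3$-subset $\{i,j,k\}$) with facets $e_{ij},e_{jk},e_{ik}$, and triangles $\Delta^i_{jk}=\Delta^i_{kj}$ (pairwise distinct $i,j,k$) with facets $e^i_j,e^i_k,e_{jk}$; the order is generated by these face relations. $\overline{\mathcal K}_n^{(1)}$ is its $1$-skeleton graph (vertices $v_i$, edges all $e_{ij},e^i_j$), and $K_n^+$ is the subgraph with all vertices and the edges $e^i_j$ (a copy of the complete graph $K_n$). A spanning subgraph contains all $n$ vertices. For a graph $H$, $(CH)^{(1)}$ is the graph obtained from $H$ by adding one new vertex joined by one edge to each vertex of $H$. A graph is Hamiltonian if it has a cycle passing through every vertex exactly once. A walk in $\overline{\mathcal K}_n$ is a sequence of edges $e_1,\dots,e_m$ with vertices $w_1,\dots,w_{m+1}$, $e_i$ having endpoints $w_i,w_{i+1}$; its length is $m$. A cycle is a walk with no repeated edge whose first and last vertices coincide. An elementary contraction replaces two consecutive edges $e_i,e_{i+1}$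 by an edge $\tilde e$ such that $e_i,e_{i+1},\tilde e$ are the three facets of a triangle; a walk can be contracted to $q$ if $q$ results from finitely many (possibly zero) elementary contractions. A subgraph $G$ of the $1$-skeleton is bypassing in $\overline{\mathcal K}_n$ if it contains all vertices and each edge $e$ of $\overline{\mathcal K}_n$ admits a walk in $G$ contractable to the one-edge walk $e$. $B_G(e)$ is the set of shortest walks in $G$ contractable to $e$. An isometric even cycle in $G$ (with respect to $\overline{\mathcal K}_n$) is a cycle in $G$ with edges $e_1,\dots,e_{2m}$ and vertices $w_1,\dots,w_{2m}$ ($e_i$ joining $w_i,w_{i+1}$, indices mod $2m$) such that for every $1\le i\le m$ there is an edge $\tilde e_i$ of $\overline{\mathcal K}_n$ not in $G$ joining $w_i$ and $w_{i+m}$ for which both walks $e_i,\dots,e_{i+m-1}$ and $e_{i+m},\dots,e_{i+2m-1}$ lie in $B_G(\tilde e_i)$; the edges $e_i$ and $e_{i+m}$ are called opposite. Let $\sim$ be the smallest equivalence relation on $E(G)$ with $e\sim e'$ whenever $e,e'$ are opposite edges of some isometric even cycle in $G$. $G$ is $1$-ic-colorable in $\overline{\mathcal K}_n$ if $\sim$ has exactly one equivalence class. -}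

module Defs where

open import Data.Nat as ℕ using (ℕ; zero; suc; _+_; _≤_)
open import Data.Nat.DivMod using (_mod_)
open import Data.Fin as Fin using (Fin; toℕ)
open import Data.Fin.Properties using (<-cmp; <⇒≢; <-trans)
open import Data.List using (List; []; _∷_; _++_; map; length; upTo; allFin; _∷ʳ_)
open import Data.List.Relation.Unary.All using (All)
open import Data.List.Relation.Unary.Linked using (Linked)
open import Data.List.Relation.Binary.Permutation.Propositional using (_↭_)
open import Data.Product using (Σ; ∃; ∃-syntax; _×_; _,_)
open import Data.Sum using (_⊎_)
open import Data.Unit using (⊤)
open import Data.Empty using (⊥; ⊥-elim)
open import Relation.Nullary using (¬_)
open import Relation.Binary.Definitions using (tri<; tri≈; tri>)
open import Relation.Binary.PropositionalEquality using (_≡_; _≢_)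
open import Relation.Binary.Construct.Closure.ReflexiveTransitive using (Star)
open import Relation.Binary.Construct.Closure.Equivalence using (EqClosure)
open import Function.Bundles using (_↔_; _⇔_; Inverse)

-- The simplicial poset  K̄_n  (only the part above rank 0 is needed:
-- vertices, edges, triangles and the face relation triangle ⊃ edge).

-- vertices v_1 … v_n  are  Fin n.

-- e_{ij} is a 'plain' edge, e^i_j is a 'plus' edge.
data Kind : Set where
  plain plus : Kind

-- An edge: its kind and its (unordered) pair of endpoints, stored
-- canonically as lo < hi.  So e_{ij}=e_{ji} and e^i_j=e^j_i.
record Edge (n : ℕ) : Set where
  constructor edge
  field
    kind  : Kind
    lo hi : Fin n
    lo<hi : lo Fin.< hi
open Edge public

Joins : ∀ {n} → Edge n → Fin n → Fin n → Set
Joins e u v = (lo e ≡ u × hi e ≡ v) ⊎ (lo e ≡ v × hi e ≡ u)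

mkE : ∀ {n} → Kind → (u v : Fin n) → u ≢ v → Edge n
mkE k u v u≢v with <-cmp u v
... | tri< u<v _ _ = edge k u v u<v
... | tri≈ _ u≡v _ = ⊥-elim (u≢v u≡v)
... | tri> _ _ v<u = edge k v u v<u

-- Triangles: Δ_{ijk} (one per 3-subset, listed with i<j<k) and
-- Δ^i_{jk} = Δ^i_{kj} (apex i, listed with j<k, i ∉ {j,k}).
data Triangle (n : ℕ) : Set where
  Δ  : (i j k : Fin n) → i Fin.< j → j Fin.< k → Triangle n
  Δ⁺ : (i j k : Fin n) → i ≢ j → i ≢ k → j Fin.< k → Triangle n

facets : ∀ {n} → Triangle n → List (Edge n)
facets (Δ i j k i<j j<k) =
  edge plain i j i<j ∷ edge plain j k j<k ∷ mkE plain i k (<⇒≢ (<-trans i<j j<k)) ∷ []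
facets (Δ⁺ i j k i≢j i≢k j<k) =
  mkE plus i j i≢j ∷ mkE plus i k i≢k ∷ edge plain j k j<k ∷ []

AreFacets : ∀ {n} → Edge n → Edge n → Edge n → Set
AreFacets e₁ e₂ e₃ = ∃[ t ] (e₁ ∷ e₂ ∷ e₃ ∷ []) ↭ facets t

record Walk (n : ℕ) : Set where
  constructor walk
  field
    edges : List (Edge n)
    verts : List (Fin n)
open Walk public

IsWalk′ : ∀ {n} → List (Edge n) → List (Fin n) → Set
IsWalk′ []       (w ∷ [])      = ⊤
IsWalk′ (e ∷ es) (w ∷ w′ ∷ ws) = Joins e w w′ × IsWalk′ es (w′ ∷ ws)
IsWalk′ _        _             = ⊥

IsWalk : ∀ {n} → Walk n → Set
IsWalk W = IsWalk′ (edges W) (verts W)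

len : ∀ {n} → Walk n → ℕ
len W = length (edges W)

-- elementary contraction: consecutive e_i, e_{i+1} (through w_i, w_{i+1}, w_{i+2})
-- replaced by ẽ, where e_i, e_{i+1}, ẽ are the three facets of a triangle
data ElemContr {n : ℕ} : Walk n → Walk n → Set where
  contr : (A : List (Edge n)) (V : List (Fin n)) (e₁ e₂ ẽ : Edge n)
          (a b c : Fin n) (B : List (Edge n)) (C : List (Fin n)) →
          length A ≡ length V → AreFacets e₁ e₂ ẽ →
          ElemContr (walk (A ++ e₁ ∷ e₂ ∷ B) (V ++ a ∷ b ∷ c ∷ C))
                    (walk (A ++ ẽ ∷ B) (V ++ a ∷ c ∷ C))

ContractsTo : ∀ {n} → Walk n → Edge n → Set
ContractsTo {n} W e = ∃[ u ] ∃[ v ] Star ElemContr W (walk (e ∷ []) (u ∷ v ∷ []))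

-- a subgraph of the 1-skeleton (all vertices, edge set given by a predicate)
Subgraph : ℕ → Set₁
Subgraph n = Edge n → Set

GWalkTo : ∀ {n} → Subgraph n → Edge n → Walk n → Set
GWalkTo G e W = IsWalk W × All G (edges W) × ContractsTo W e

Bypassing : ∀ {n} → Subgraph n → Set
Bypassing {n} G = (e : Edge n) → ∃[ W ] GWalkTo G e W

InB : ∀ {n} → Subgraph n → Edge n → Walk n → Set
InB {n} G e W = GWalkTo G e W × ((W′ : Walk n) → GWalkTo G e W′ → len W ≤ len W′)

-- Even cycles of length 2m, m = suc k, indices taken mod 2m (0-based).

record EvenCycle (n : ℕ) : Set where
  field
    k : ℕ
    E : Fin (suc k + suc k) → Edge n
    W : Fin (suc k + suc k) → Fin n

module _ {n : ℕ} (C : EvenCycle n) where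
  open EvenCycle C
  half : ℕ
  half = suc k
  cE : ℕ → Edge n
  cE i = E (i mod (suc k + suc k))
  cW : ℕ → Fin n
  cW i = W (i mod (suc k + suc k))
  segment : ℕ → Walk n
  segment i = walk (map (λ j → cE (i + j)) (upTo half))
                   (map (λ j → cW (i + j)) (upTo (suc half)))

IsIsometricEvenCycle : ∀ {n} → Subgraph n → EvenCycle n → Set
IsIsometricEvenCycle {n} G C =
  ((i : Fin (suc k + suc k)) → G (E i)) ×
  ((i : Fin (suc k + suc k)) → Joins (E i) (W i) (cW C (suc (toℕ i)))) ×
  ((i j : Fin (suc k + suc k)) → E i ≡ E j → i ≡ j) ×
  ((i : ℕ) → i ℕ.< half C →
     ∃[ ẽ ] (¬ G ẽ × Joins ẽ (cW C i) (cW C (i + half C)) ×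
             InB G ẽ (segment C i) × InB G ẽ (segment C (i + half C))))
  where open EvenCycle C

Opposite : ∀ {n} → Subgraph n → Edge n → Edge n → Set
Opposite {n} G e e′ = ∃[ C ] (IsIsometricEvenCycle G C ×
  ∃[ i ] (i ℕ.< half C × e ≡ cE C i × e′ ≡ cE C (i + half C)))

-- 1-ic-colorable: the equivalence relation generated by "opposite" on E(G)
-- has exactly one class
OneIcColorable : ∀ {n} → Subgraph n → Set
OneIcColorable {n} G =
  (∃[ e ] G e) × ((e e′ : Edge n) → G e → G e′ → EqClosure (Opposite G) e e′)

record SimpleGraph (m : ℕ) : Set₁ where
  field
    Adj   : Fin m → Fin m → Set
    sym   : ∀ {u v} → Adj u v → Adj v u
    irrefl : ∀ {u} → ¬ Adj u u
open SimpleGraph public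

Hamiltonian : ∀ {m} → SimpleGraph m → Set
Hamiltonian {m} H = ∃[ v ] ∃[ rest ]
  ((v ∷ rest) ↭ allFin m × 3 ≤ length (v ∷ rest) × Linked (Adj H) ((v ∷ rest) ∷ʳ v))

-- (CH)^{(1)}: new vertex 0 joined to every old vertex suc i
ConeAdj : ∀ {m} → SimpleGraph m → Fin (suc m) → Fin (suc m) → Set
ConeAdj H Fin.zero    Fin.zero    = ⊥
ConeAdj H Fin.zero    (Fin.suc j) = ⊤
ConeAdj H (Fin.suc i) Fin.zero    = ⊤
ConeAdj H (Fin.suc i) (Fin.suc j) = Adj H i j

GAdj : ∀ {n} → Subgraph n → Fin n → Fin n → Set
GAdj G u v = ∃[ e ] (G e × Joins e u v)

IsoToCone : ∀ {n m} → Subgraph n → SimpleGraph m → Set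
IsoToCone {n} {m} G H = Σ (Fin n ↔ Fin (suc m)) λ φ →
  (u v : Fin n) → GAdj G u v ⇔ ConeAdj H (Inverse.to φ u) (Inverse.to φ v)

{-# OPTIONS --safe #-}
module Submission where

-- G ≅ (CH)⁽¹⁾ is a wheel: a hub joined to every vertex of a rim cycle of length n − 1 (the
-- Hamiltonian cycle of H), possibly with further chords. Since G has only plus edges, a path
-- a–b–c in G contracts through Δ⁺ with apex b to the plain edge ac, and a path a′–a–b–c to the
-- plus edge a′c. Any two vertices of a wheel have a common neighbour, so every edge of K̄ₙ is
-- reached in this way: G is bypassing. Plain edges are not in G, so those 2-paths are shortest
-- and every 4-cycle of G is an isometric even cycle. The 4-cycles through the hub and three
-- consecutive rim vertices make the spoke at rim i equivalent to the spoke at rim (i + 3); as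
-- 3 ∤ n − 1 all spokes fall into one class, and every other edge of G is opposite to a spoke in
-- some 4-cycle.

open import Defs
open import Data.Nat using (ℕ; zero; suc; _+_; _*_; _≤_; _∸_; z≤n; s≤s)
open import Data.Nat.Properties using (+-suc; m≤n⇒m≤1+n)
open import Data.Nat.DivMod using (_divMod_; result)
open import Data.Nat.Divisibility using (_∣_; divides)
open import Data.Fin as Fin using (Fin)
open import Data.Fin.Properties using (<-cmp; <⇒≢; <-irrelevant; <-asym; _≟_; cantor-schröder-bernstein; suc-injective)
open import Data.List using (List; []; _∷_; _++_; [_]; length; allFin; _∷ʳ_)
open import Data.List.Properties using (++-assoc; length-tabulate)
open import Data.List.Relation.Unary.All using (All; []; _∷_)
open import Data.List.Relation.Unary.Any using (here; there)
open import Data.List.Relation.Unary.AllPairs using (_∷_)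
open import Data.List.Relation.Unary.Linked using (Linked; [-]; _∷_)
open import Data.List.Relation.Unary.Unique.Propositional using (Unique)
open import Data.List.Relation.Unary.Unique.Propositional.Properties using (allFin⁺)
open import Data.List.Membership.Propositional using (_∈_)
open import Data.List.Membership.Propositional.Properties using (∈-∃++; ∈-allFin)
open import Data.List.Relation.Binary.Permutation.Propositional using (_↭_; refl; prep; swap; trans; ↭-sym; ↭-reflexive; ↭⇒↭ₛ)
open import Data.List.Relation.Binary.Permutation.Propositional.Properties using (∈-resp-↭; ↭-length; ∷↭∷ʳ)
import Data.List.Relation.Binary.Permutation.Setoid.Properties as Permutationₛ
open import Data.Vec as Vec using ([]; _∷_)
open import Data.Vec.Relation.Unary.All using ([]; _∷_)
open import Data.Vec.Relation.Unary.All.Properties using (lookup⁺)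
open import Data.Vec.Relation.Unary.AllPairs using ([]; _∷_)
import Data.Vec.Relation.Unary.Unique.Propositional as Vec
open import Data.Vec.Relation.Unary.Unique.Propositional.Properties using (lookup-injective)
open import Data.Product using (Σ; ∃-syntax; _×_; _,_; proj₁; proj₂)
open import Data.Sum using (_⊎_; inj₁; inj₂)
open import Data.Empty using (⊥-elim)
open import Function using (_∘_; id)
open import Function.Bundles using (Inverse; Equivalence; Injection)
open import Function.Properties.Inverse using (↔⇒↣; ↔-sym)
open import Relation.Nullary using (¬_; yes; no)
open import Relation.Binary.Core using (Rel)
open import Relation.Binary.Definitions using (tri<; tri≈; tri>)
open import Relation.Binary.PropositionalEquality as ≡
  using (_≡_; _≢_; refl; cong; cong₂; subst; subst₂; setoid; module ≡-Reasoning)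
open import Relation.Binary.Construct.Closure.ReflexiveTransitive using (Star; ε; _◅_)
open import Relation.Binary.Construct.Closure.Equivalence using (EqClosure; return; symmetric; transitive; reflexive)

-- Edges and triangles of K̄ₙ

module _ {n : ℕ} where

  Joins-sym : ∀ {e : Edge n} {u v} → Joins e u v → Joins e v u
  Joins-sym (inj₁ p) = inj₂ p
  Joins-sym (inj₂ p) = inj₁ p

  Joins-self : (e : Edge n) → Joins e (lo e) (hi e)
  Joins-self e = inj₁ (refl , refl)

  Joins⇒≢ : ∀ {e : Edge n} {u v} → Joins e u v → u ≢ v
  Joins⇒≢ {edge _ _ _ lo<hi} (inj₁ (refl , refl)) = <⇒≢ lo<hi
  Joins⇒≢ {edge _ _ _ lo<hi} (inj₂ (refl , refl)) = <⇒≢ lo<hi ∘ ≡.sym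

  Joins-unique : ∀ {e e′ : Edge n} {u v} → kind e ≡ kind e′ → Joins e u v → Joins e′ u v → e ≡ e′
  Joins-unique {edge k l h p} {edge _ _ _ p′} refl (inj₁ (refl , refl)) (inj₁ (refl , refl)) =
    cong (edge k l h) (<-irrelevant p p′)
  Joins-unique {edge _ _ _ p} {edge _ _ _ p′} refl (inj₁ (refl , refl)) (inj₂ (refl , refl)) =
    ⊥-elim (<-asym p p′)
  Joins-unique {edge _ _ _ p} {edge _ _ _ p′} refl (inj₂ (refl , refl)) (inj₁ (refl , refl)) =
    ⊥-elim (<-asym p p′)
  Joins-unique {edge k l h p} {edge _ _ _ p′} refl (inj₂ (refl , refl)) (inj₂ (refl , refl)) =
    cong (edge k l h) (<-irrelevant p p′)

  Joins⇒≢-edge : ∀ {e e′ : Edge n} {a b c d} → Joins e a b → Joins e′ c d → a ≢ c → a ≢ d → e ≢ e′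
  Joins⇒≢-edge (inj₁ (refl , _)) (inj₁ (a≡c , _)) a≢c _   refl = a≢c a≡c
  Joins⇒≢-edge (inj₁ (refl , _)) (inj₂ (a≡d , _)) _   a≢d refl = a≢d a≡d
  Joins⇒≢-edge (inj₂ (_ , refl)) (inj₁ (_ , a≡d)) _   a≢d refl = a≢d a≡d
  Joins⇒≢-edge (inj₂ (_ , refl)) (inj₂ (_ , a≡c)) a≢c _   refl = a≢c a≡c

  mkE-kind : ∀ k (u v : Fin n) u≢v → kind (mkE k u v u≢v) ≡ k
  mkE-kind k u v u≢v with <-cmp u v
  ... | tri< _ _ _   = refl
  ... | tri≈ _ u≡v _ = ⊥-elim (u≢v u≡v)
  ... | tri> _ _ _   = refl

  mkE-joins : ∀ k (u v : Fin n) u≢v → Joins (mkE k u v u≢v) u v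
  mkE-joins k u v u≢v with <-cmp u v
  ... | tri< _ _ _   = inj₁ (refl , refl)
  ... | tri≈ _ u≡v _ = ⊥-elim (u≢v u≡v)
  ... | tri> _ _ _   = inj₂ (refl , refl)

  Joins⇒≡mkE : ∀ {e : Edge n} {k u v} u≢v → kind e ≡ k → Joins e u v → e ≡ mkE k u v u≢v
  Joins⇒≡mkE {k = k} {u} {v} u≢v refl j = Joins-unique (≡.sym (mkE-kind k u v u≢v)) j (mkE-joins k u v u≢v)

  AreFacets-swap₁₂ : ∀ {e₁ e₂ e₃ : Edge n} → AreFacets e₁ e₂ e₃ → AreFacets e₂ e₁ e₃
  AreFacets-swap₁₂ {e₁} {e₂} (t , p) = t , trans (swap e₂ e₁ refl) p

  AreFacets-swap₂₃ : ∀ {e₁ e₂ e₃ : Edge n} → AreFacets e₁ e₂ e₃ → AreFacets e₁ e₃ e₂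
  AreFacets-swap₂₃ {e₁} {e₂} {e₃} (t , p) = t , trans (prep e₁ (swap e₃ e₂ refl)) p

  Δ⁺-facets< : ∀ {e₁ e₂ x : Edge n} {a b c} → kind e₁ ≡ plus → kind e₂ ≡ plus → kind x ≡ plain →
               Joins e₁ b a → Joins e₂ b c → Joins x a c → a Fin.< c → AreFacets e₁ e₂ x
  Δ⁺-facets< {e₁} {e₂} {a = a} {b} {c} k₁ k₂ kx j₁ j₂ jx a<c =
    Δ⁺ b a c b≢a b≢c a<c ,
    ↭-reflexive (cong₂ _∷_ (Joins⇒≡mkE b≢a k₁ j₁) (cong₂ _∷_ (Joins⇒≡mkE b≢c k₂ j₂)
                (cong [_] (Joins-unique kx jx (inj₁ (refl , refl))))))
    where
    b≢a : b ≢ a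
    b≢a = Joins⇒≢ {e = e₁} j₁
    b≢c : b ≢ c
    b≢c = Joins⇒≢ {e = e₂} j₂

  Δ⁺-facets : ∀ {e₁ e₂ x : Edge n} {a b c} → kind e₁ ≡ plus → kind e₂ ≡ plus → kind x ≡ plain →
              Joins e₁ b a → Joins e₂ b c → Joins x a c → AreFacets e₁ e₂ x
  Δ⁺-facets {x = x} {a = a} {c = c} k₁ k₂ kx j₁ j₂ jx with <-cmp a c
  ... | tri< a<c _ _ = Δ⁺-facets< k₁ k₂ kx j₁ j₂ jx a<c
  ... | tri≈ _ a≡c _ = ⊥-elim (Joins⇒≢ {e = x} jx a≡c)
  ... | tri> _ _ c<a = AreFacets-swap₁₂ (Δ⁺-facets< k₂ k₁ kx j₂ j₁ (Joins-sym {e = x} jx) c<a)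

-- Contracting short walks of a subgraph of K⁺

SubgraphOfK⁺ : ∀ {n} → Subgraph n → Set
SubgraphOfK⁺ {n} G = (e : Edge n) → G e → kind e ≡ plus

CommonNeighbours : ∀ {n} → Subgraph n → Set
CommonNeighbours {n} G = ∀ {u v : Fin n} → u ≢ v → ∃[ w ] (GAdj G u w × GAdj G w v)

GAdj-sym : ∀ {n} {G : Subgraph n} {u v} → GAdj G u v → GAdj G v u
GAdj-sym (e , e∈G , j) = e , e∈G , Joins-sym {e = e} j

module _ {n : ℕ} {G : Subgraph n} where

  walk₂ : ∀ {a b c} → GAdj G a b → GAdj G b c → Walk n
  walk₂ {a} {b} {c} p q = walk (proj₁ p ∷ proj₁ q ∷ []) (a ∷ b ∷ c ∷ [])

  walk₃ : ∀ {a b c d} → GAdj G a b → GAdj G b c → GAdj G c d → Walk n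
  walk₃ {a} {b} {c} {d} p q r = walk (proj₁ p ∷ proj₁ q ∷ proj₁ r ∷ []) (a ∷ b ∷ c ∷ d ∷ [])

  private
    2≤length : ∀ (A : List (Edge n)) e₁ e₂ B → 2 ≤ length (A ++ e₁ ∷ e₂ ∷ B)
    2≤length []      _  _  _ = s≤s (s≤s z≤n)
    2≤length (_ ∷ A) e₁ e₂ B = m≤n⇒m≤1+n (2≤length A e₁ e₂ B)

    contraction-length : ∀ {W x u v} → Star ElemContr W (walk [ x ] (u ∷ v ∷ [])) →
                         All G (edges W) → ¬ G x → 2 ≤ len W
    contraction-length ε (x∈G ∷ []) x∉G = ⊥-elim (x∉G x∈G)
    contraction-length (contr A _ e₁ e₂ _ _ _ _ B _ _ _ ◅ _) _ _ = 2≤length A e₁ e₂ B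

  ∉G⇒2≤len : ∀ {x W} → ¬ G x → GWalkTo G x W → 2 ≤ len W
  ∉G⇒2≤len x∉G (_ , W⊆G , _ , _ , W↠x) = contraction-length W↠x W⊆G x∉G

module _ {n : ℕ} {G : Subgraph n} (G⊆K⁺ : SubgraphOfK⁺ G) where

  plain∉G : ∀ {x} → kind x ≡ plain → ¬ G x
  plain∉G {x} kx x∈G with ≡.trans (≡.sym kx) (G⊆K⁺ x x∈G)
  ... | ()

  walk₂-contracts : ∀ {a b c x} (p : GAdj G a b) (q : GAdj G b c) →
                    kind x ≡ plain → Joins x a c → GWalkTo G x (walk₂ p q)
  walk₂-contracts {a} {b} {c} {x} (e₁ , g₁ , j₁) (e₂ , g₂ , j₂) kx jx =
    (j₁ , j₂ , _) , g₁ ∷ g₂ ∷ [] , a , c ,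
    contr [] [] e₁ e₂ x a b c [] [] refl
      (Δ⁺-facets (G⊆K⁺ e₁ g₁) (G⊆K⁺ e₂ g₂) kx (Joins-sym {e = e₁} j₁) j₂ jx) ◅ ε

  walk₂-shortest : ∀ {a b c x} (p : GAdj G a b) (q : GAdj G b c) →
                   kind x ≡ plain → Joins x a c → InB G x (walk₂ p q)
  walk₂-shortest p q kx jx = walk₂-contracts p q kx jx , λ _ → ∉G⇒2≤len (plain∉G kx)

  -- First contract the last two edges to the plain edge ac, then use Δ⁺ with apex a′.
  walk₃-contracts : ∀ {a′ a b c t} (p : GAdj G a′ a) (q : GAdj G a b) (r : GAdj G b c) →
                    a ≢ c → kind t ≡ plus → Joins t a′ c → GWalkTo G t (walk₃ p q r)
  walk₃-contracts {a′} {a} {b} {c} {t} (e₁ , g₁ , j₁) (e₂ , g₂ , j₂) (e₃ , g₃ , j₃) a≢c kt jt =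
    (j₁ , j₂ , j₃ , _) , g₁ ∷ g₂ ∷ g₃ ∷ [] , a′ , c ,
    contr [ e₁ ] [ a′ ] e₂ e₃ ac a b c [] [] refl
      (Δ⁺-facets (G⊆K⁺ e₂ g₂) (G⊆K⁺ e₃ g₃) kac (Joins-sym {e = e₂} j₂) j₃ jac) ◅
    contr [] [] e₁ ac t a′ a c [] [] refl
      (AreFacets-swap₂₃ (Δ⁺-facets (G⊆K⁺ e₁ g₁) kt kac j₁ jt jac)) ◅ ε
    where
    ac : Edge n
    ac = mkE plain a c a≢c
    kac : kind ac ≡ plain
    kac = mkE-kind plain a c a≢c
    jac : Joins ac a c
    jac = mkE-joins plain a c a≢c

  common-neighbours⇒bypassing : CommonNeighbours G → Bypassing G
  common-neighbours⇒bypassing common e@(edge plain u v u<v) with common (<⇒≢ u<v)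
  ... | _ , p , q = walk₂ p q , walk₂-contracts p q refl (Joins-self e)
  common-neighbours⇒bypassing common e@(edge plus u v u<v) with common (<⇒≢ u<v)
  ... | _ , p , (av , _ , a–v) with common (Joins⇒≢ {e = av} a–v)
  ...   | _ , q , r = walk₃ p q r , walk₃-contracts p q r (Joins⇒≢ {e = av} a–v) refl (Joins-self e)

  square : ∀ {w₀ w₁ w₂ w₃} → GAdj G w₀ w₁ → GAdj G w₁ w₂ → GAdj G w₂ w₃ → GAdj G w₃ w₀ → EvenCycle n
  square {w₀} {w₁} {w₂} {w₃} e₀ e₁ e₂ e₃ = record
    { k = 1
    ; E = Vec.lookup (proj₁ e₀ ∷ proj₁ e₁ ∷ proj₁ e₂ ∷ proj₁ e₃ ∷ [])
    ; W = Vec.lookup (w₀ ∷ w₁ ∷ w₂ ∷ w₃ ∷ [])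
    }

  diagonal : ∀ {a b c d} → a ≢ c → (p : GAdj G a b) (q : GAdj G b c) (r : GAdj G c d) (s : GAdj G d a) →
             ∃[ ẽ ] (¬ G ẽ × Joins ẽ a c × InB G ẽ (walk₂ p q) × InB G ẽ (walk₂ r s))
  diagonal {a} {c = c} a≢c p q r s =
    ac , plain∉G kac , jac , walk₂-shortest p q kac jac , walk₂-shortest r s kac (Joins-sym {e = ac} jac)
    where
    ac : Edge n
    ac = mkE plain a c a≢c
    kac : kind ac ≡ plain
    kac = mkE-kind plain a c a≢c
    jac : Joins ac a c
    jac = mkE-joins plain a c a≢c

  square-isometric : ∀ {w₀ w₁ w₂ w₃}
                     (e₀ : GAdj G w₀ w₁) (e₁ : GAdj G w₁ w₂) (e₂ : GAdj G w₂ w₃) (e₃ : GAdj G w₃ w₀) →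
                     w₀ ≢ w₂ → w₁ ≢ w₃ → IsIsometricEvenCycle G (square e₀ e₁ e₂ e₃)
  square-isometric {w₀} {w₁} {w₂} {w₃}
                   e₀@(E₀ , g₀ , j₀) e₁@(E₁ , g₁ , j₁) e₂@(E₂ , g₂ , j₂) e₃@(E₃ , g₃ , j₃) w₀≢w₂ w₁≢w₃ =
    lookup⁺ {P = G} (g₀ ∷ g₁ ∷ g₂ ∷ g₃ ∷ []) ,
    (λ { Fin.zero                            → j₀
       ; (Fin.suc Fin.zero)                  → j₁
       ; (Fin.suc (Fin.suc Fin.zero))        → j₂
       ; (Fin.suc (Fin.suc (Fin.suc Fin.zero))) → j₃
       }) ,
    lookup-injective edges-distinct ,
    λ { 0 _ → diagonal w₀≢w₂ e₀ e₁ e₂ e₃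
      ; 1 _ → diagonal w₁≢w₃ e₁ e₂ e₃ e₀
      ; (suc (suc _)) (s≤s (s≤s ())) }
    where
    w₁≢w₀ : w₁ ≢ w₀
    w₁≢w₀ = Joins⇒≢ {e = E₀} j₀ ∘ ≡.sym
    w₁≢w₂ : w₁ ≢ w₂
    w₁≢w₂ = Joins⇒≢ {e = E₁} j₁
    w₂≢w₃ : w₂ ≢ w₃
    w₂≢w₃ = Joins⇒≢ {e = E₂} j₂
    w₀≢w₃ : w₀ ≢ w₃
    w₀≢w₃ = Joins⇒≢ {e = E₃} j₃ ∘ ≡.sym
    edges-distinct : Vec.Unique (E₀ ∷ E₁ ∷ E₂ ∷ E₃ ∷ [])
    edges-distinct =
      (Joins⇒≢-edge j₀ j₁ (w₁≢w₀ ∘ ≡.sym) w₀≢w₂ ∷ Joins⇒≢-edge j₀ j₂ w₀≢w₂ w₀≢w₃ ∷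
       Joins⇒≢-edge (Joins-sym {e = E₀} j₀) j₃ w₁≢w₃ w₁≢w₀ ∷ []) ∷
      (Joins⇒≢-edge j₁ j₂ w₁≢w₂ w₁≢w₃ ∷ Joins⇒≢-edge j₁ j₃ w₁≢w₃ w₁≢w₀ ∷ []) ∷
      (Joins⇒≢-edge j₂ j₃ w₂≢w₃ (w₀≢w₂ ∘ ≡.sym) ∷ []) ∷ [] ∷ []

  square-opposite : ∀ {w₀ w₁ w₂ w₃}
                    (e₀ : GAdj G w₀ w₁) (e₁ : GAdj G w₁ w₂) (e₂ : GAdj G w₂ w₃) (e₃ : GAdj G w₃ w₀) →
                    w₀ ≢ w₂ → w₁ ≢ w₃ → Opposite G (proj₁ e₀) (proj₁ e₂) × Opposite G (proj₁ e₁) (proj₁ e₃)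
  square-opposite e₀ e₁ e₂ e₃ w₀≢w₂ w₁≢w₃ =
    (square e₀ e₁ e₂ e₃ , isometric , 0 , s≤s z≤n , refl , refl) ,
    (square e₀ e₁ e₂ e₃ , isometric , 1 , s≤s (s≤s z≤n) , refl , refl)
    where
    isometric : IsIsometricEvenCycle G (square e₀ e₁ e₂ e₃)
    isometric = square-isometric e₀ e₁ e₂ e₃ w₀≢w₂ w₁≢w₃

-- Lists read cyclically

module _ {a} {A : Set a} where

  -- cycleAt x xs is the periodic sequence x, xs, x, xs, …; each step rotates the list by one.
  cycleAt : A → List A → ℕ → A
  cycleAt x xs       zero    = x
  cycleAt x []       (suc i) = cycleAt x [] i
  cycleAt x (y ∷ ys) (suc i) = cycleAt y (ys ∷ʳ x) i

  cycleAt-++ : ∀ x ys z zs i → cycleAt x (ys ++ z ∷ zs) (suc (length ys) + i) ≡ cycleAt z (zs ++ x ∷ ys) i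
  cycleAt-++ x []       z zs i = refl
  cycleAt-++ x (w ∷ ws) z zs i = begin
    cycleAt w ((ws ++ z ∷ zs) ∷ʳ x) (suc (length ws) + i)
      ≡⟨ cong (λ l → cycleAt w l (suc (length ws) + i)) (++-assoc ws (z ∷ zs) [ x ]) ⟩
    cycleAt w (ws ++ z ∷ (zs ∷ʳ x)) (suc (length ws) + i)
      ≡⟨ cycleAt-++ w ws z (zs ∷ʳ x) i ⟩
    cycleAt z ((zs ∷ʳ x) ++ w ∷ ws) i
      ≡⟨ cong (λ l → cycleAt z l i) (++-assoc zs [ x ] (w ∷ ws)) ⟩
    cycleAt z (zs ++ x ∷ w ∷ ws) i
      ∎
    where open ≡-Reasoning

  cycleAt-periodic : ∀ x xs i → cycleAt x xs (length (x ∷ xs) + i) ≡ cycleAt x xs i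
  cycleAt-periodic x []       i = refl
  cycleAt-periodic x (y ∷ ys) i = cycleAt-++ y ys x [] i

  cycleAt-surjective : ∀ {x xs u} → u ∈ x ∷ xs → ∃[ i ] cycleAt x xs i ≡ u
  cycleAt-surjective (here refl) = 0 , refl
  cycleAt-surjective {x} (there u∈xs) with ∈-∃++ u∈xs
  ... | ys , zs , refl = suc (length ys) + 0 , cycleAt-++ x ys _ zs 0

  module _ {ℓ} {R : Rel A ℓ} where

    Linked-∷ʳ⁺ : ∀ {x y} xs → Linked R (xs ∷ʳ x) → R x y → Linked R (xs ∷ʳ x ∷ʳ y)
    Linked-∷ʳ⁺ []           [-]       Rxy = Rxy ∷ [-]
    Linked-∷ʳ⁺ (_ ∷ [])     (r ∷ [-]) Rxy = r ∷ Rxy ∷ [-]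
    Linked-∷ʳ⁺ (_ ∷ w ∷ ws) (r ∷ rs)  Rxy = r ∷ Linked-∷ʳ⁺ (w ∷ ws) rs Rxy

    cycleAt-linked : ∀ {x xs} → Linked R ((x ∷ xs) ∷ʳ x) → ∀ i → R (cycleAt x xs i) (cycleAt x xs (suc i))
    cycleAt-linked {xs = []}     (Rxx ∷ [-]) zero    = Rxx
    cycleAt-linked {xs = []}     linked      (suc i) = cycleAt-linked linked i
    cycleAt-linked {xs = _ ∷ _}  (Rxy ∷ _)   zero    = Rxy
    cycleAt-linked {xs = y ∷ ys} (Rxy ∷ rs)  (suc i) = cycleAt-linked (Linked-∷ʳ⁺ (y ∷ ys) rs Rxy) i

  cycleAt-≢-2+ : ∀ {x xs} → Unique (x ∷ xs) → 3 ≤ length (x ∷ xs) → ∀ i → cycleAt x xs i ≢ cycleAt x xs (2 + i)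
  cycleAt-≢-2+ {xs = []}         _                   (s≤s ())
  cycleAt-≢-2+ {xs = _ ∷ []}     _                   (s≤s (s≤s ()))
  cycleAt-≢-2+ {xs = _ ∷ _ ∷ _}  ((_ ∷ x≢z ∷ _) ∷ _) _   zero    = x≢z
  cycleAt-≢-2+ {x} {xs = y ∷ ys} unique              3≤ (suc i) =
    cycleAt-≢-2+ (Permutationₛ.Unique-resp-↭ (setoid A) (↭⇒↭ₛ rotation) unique)
                 (subst (3 ≤_) (↭-length rotation) 3≤) i
    where
    rotation : x ∷ y ∷ ys ↭ y ∷ (ys ∷ʳ x)
    rotation = ∷↭∷ʳ x (y ∷ ys)

-- Wheels

¬3∣⇒k*3≡n±1 : ∀ {n} → ¬ 3 ∣ n → ∃[ k ] (k * 3 ≡ suc n ⊎ suc (k * 3) ≡ n)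
¬3∣⇒k*3≡n±1 {n} 3∤n with n divMod 3
... | result q Fin.zero                     n≡q*3   = ⊥-elim (3∤n (divides q n≡q*3))
... | result q (Fin.suc Fin.zero)           n≡1+q*3 = q , inj₂ (≡.sym n≡1+q*3)
... | result q (Fin.suc (Fin.suc Fin.zero)) n≡2+q*3 = suc q , inj₁ (cong suc (≡.sym n≡2+q*3))

-- (CH)⁽¹⁾ with a Hamiltonian cycle of H as its rim, indexed by ℕ; further chords of H are allowed.
record Wheel {n} (G : Subgraph n) : Set where
  field
    period       : ℕ
    hub          : Fin n
    rim          : ℕ → Fin n
    rim-periodic : ∀ i → rim (period + i) ≡ rim i
    spoke        : ∀ i → GAdj G hub (rim i)
    rim-adj      : ∀ i → GAdj G (rim i) (rim (suc i))
    rim-≢-2+     : ∀ i → rim i ≢ rim (2 + i)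
    hub-or-rim   : ∀ u → u ≡ hub ⊎ ∃[ i ] u ≡ rim i

module WheelProperties {n} {G : Subgraph n} (W : Wheel G) where
  open Wheel W

  spokeEdge : ℕ → Edge n
  spokeEdge i = proj₁ (spoke i)

  spoke∈G : ∀ i → G (spokeEdge i)
  spoke∈G i = proj₁ (proj₂ (spoke i))

  spoke-joins : ∀ i → Joins (spokeEdge i) hub (rim i)
  spoke-joins i = proj₂ (proj₂ (spoke i))

  hub≢rim : ∀ i → hub ≢ rim i
  hub≢rim i = Joins⇒≢ {e = spokeEdge i} (spoke-joins i)

  common-neighbours : CommonNeighbours G
  common-neighbours {u} {v} u≢v with hub-or-rim u | hub-or-rim v
  ... | inj₁ refl       | inj₁ refl       = ⊥-elim (u≢v refl)
  ... | inj₁ refl       | inj₂ (j , refl) = rim (suc j) , spoke (suc j) , GAdj-sym (rim-adj j)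
  ... | inj₂ (i , refl) | inj₁ refl       = rim (suc i) , rim-adj i , GAdj-sym (spoke (suc i))
  ... | inj₂ (i , refl) | inj₂ (j , refl) = hub , GAdj-sym (spoke i) , spoke j

  module _ (G⊆K⁺ : SubgraphOfK⁺ G) where

    private
      _~_ : Edge n → Edge n → Set
      _~_ = EqClosure (Opposite G)

      ~-refl : ∀ {e} → e ~ e
      ~-refl = reflexive (Opposite G)

      ~-sym : ∀ {e e′} → e ~ e′ → e′ ~ e
      ~-sym = symmetric (Opposite G)

      ~-trans : ∀ {e e′ e″} → e ~ e′ → e′ ~ e″ → e ~ e″
      ~-trans = transitive (Opposite G)

    spoke-unique : ∀ {e i} → G e → Joins e hub (rim i) → e ≡ spokeEdge i
    spoke-unique {e} {i} e∈G jₑ =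
      Joins-unique (≡.trans (G⊆K⁺ e e∈G) (≡.sym (G⊆K⁺ _ (spoke∈G i)))) jₑ (spoke-joins i)

    spokeEdge-periodic : ∀ i → spokeEdge (period + i) ≡ spokeEdge i
    spokeEdge-periodic i =
      spoke-unique (spoke∈G (period + i))
                   (subst (Joins (spokeEdge (period + i)) hub) (rim-periodic i) (spoke-joins (period + i)))

    fan-opposite : ∀ i → Opposite G (spokeEdge i) (proj₁ (rim-adj (suc i))) ×
                         Opposite G (proj₁ (rim-adj i)) (spokeEdge (2 + i))
    fan-opposite i = square-opposite G⊆K⁺ (spoke i) (rim-adj i) (rim-adj (suc i)) (GAdj-sym (spoke (2 + i)))
                       (hub≢rim (suc i)) (rim-≢-2+ i)

    spoke~spoke-3+ : ∀ i → spokeEdge i ~ spokeEdge (3 + i)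
    spoke~spoke-3+ i = ~-trans (return (proj₁ (fan-opposite i))) (return (proj₂ (fan-opposite (suc i))))

    spoke~spoke-k*3+ : ∀ k i → spokeEdge i ~ spokeEdge (k * 3 + i)
    spoke~spoke-k*3+ zero    i = ~-refl
    spoke~spoke-k*3+ (suc k) i = ~-trans (spoke~spoke-k*3+ k i) (spoke~spoke-3+ (k * 3 + i))

    spoke~spoke-suc : ¬ 3 ∣ period → ∀ i → spokeEdge i ~ spokeEdge (suc i)
    spoke~spoke-suc 3∤p i with ¬3∣⇒k*3≡n±1 3∤p
    ... | k , inj₁ k*3≡1+p = subst (spokeEdge i ~_) k*3+i≡1+i (spoke~spoke-k*3+ k i)
      where
      open ≡-Reasoning
      k*3+i≡1+i : spokeEdge (k * 3 + i) ≡ spokeEdge (suc i)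
      k*3+i≡1+i = begin
        spokeEdge (k * 3 + i)      ≡⟨ cong (λ m → spokeEdge (m + i)) k*3≡1+p ⟩
        spokeEdge (suc period + i) ≡⟨ cong spokeEdge (+-suc period i) ⟨
        spokeEdge (period + suc i) ≡⟨ spokeEdge-periodic (suc i) ⟩
        spokeEdge (suc i)          ∎
    ... | k , inj₂ 1+k*3≡p = ~-sym (subst (spokeEdge (suc i) ~_) k*3+1+i≡i (spoke~spoke-k*3+ k (suc i)))
      where
      open ≡-Reasoning
      k*3+1+i≡i : spokeEdge (k * 3 + suc i) ≡ spokeEdge i
      k*3+1+i≡i = begin
        spokeEdge (k * 3 + suc i)   ≡⟨ cong spokeEdge (+-suc (k * 3) i) ⟩
        spokeEdge (suc (k * 3) + i) ≡⟨ cong (λ m → spokeEdge (m + i)) 1+k*3≡p ⟩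
        spokeEdge (period + i)      ≡⟨ spokeEdge-periodic i ⟩
        spokeEdge i                 ∎

    spoke₀~spoke : ¬ 3 ∣ period → ∀ i → spokeEdge 0 ~ spokeEdge i
    spoke₀~spoke 3∤p zero    = ~-refl
    spoke₀~spoke 3∤p (suc i) = ~-trans (spoke₀~spoke 3∤p i) (spoke~spoke-suc 3∤p i)

    chord-opposite-spoke : ∀ {e i j} → G e → Joins e (rim i) (rim j) → ∃[ k ] Opposite G (spokeEdge k) e
    chord-opposite-spoke {e} {i} {j} e∈G jₑ with rim j ≟ rim (suc i)
    ... | no rim-j≢ = suc i , proj₁
      (square-opposite G⊆K⁺ (spoke (suc i)) (GAdj-sym (rim-adj i)) (e , e∈G , jₑ) (GAdj-sym (spoke j))
        (hub≢rim i) (rim-j≢ ∘ ≡.sym))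
    ... | yes rim-j≡ = 2 + i , proj₁
      (square-opposite G⊆K⁺ (spoke (2 + i)) (GAdj-sym (rim-adj (suc i)))
        (e , e∈G , Joins-sym {e = e} (subst (Joins e (rim i)) rim-j≡ jₑ)) (GAdj-sym (spoke i))
        (hub≢rim (suc i)) (rim-≢-2+ i ∘ ≡.sym))

    hub-edge~spoke₀ : ¬ 3 ∣ period → ∀ {e j} → G e → Joins e hub (rim j) → e ~ spokeEdge 0
    hub-edge~spoke₀ 3∤p {j = j} e∈G jₑ =
      subst (_~ spokeEdge 0) (≡.sym (spoke-unique e∈G jₑ)) (~-sym (spoke₀~spoke 3∤p j))

    chord~spoke₀ : ¬ 3 ∣ period → ∀ {e i j} → G e → Joins e (rim i) (rim j) → e ~ spokeEdge 0
    chord~spoke₀ 3∤p e∈G jₑ with chord-opposite-spoke e∈G jₑ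
    ... | k , opposite = ~-sym (~-trans (spoke₀~spoke 3∤p k) (return opposite))

    edge~spoke₀ : ¬ 3 ∣ period → ∀ {e} → G e → e ~ spokeEdge 0
    edge~spoke₀ 3∤p {e} e∈G with hub-or-rim (lo e) | hub-or-rim (hi e)
    ... | inj₁ lo≡hub       | inj₁ hi≡hub       =
      ⊥-elim (Joins⇒≢ {e = e} (Joins-self e) (≡.trans lo≡hub (≡.sym hi≡hub)))
    ... | inj₁ lo≡hub       | inj₂ (_ , hi≡rim) =
      hub-edge~spoke₀ 3∤p e∈G (subst₂ (Joins e) lo≡hub hi≡rim (Joins-self e))
    ... | inj₂ (_ , lo≡rim) | inj₁ hi≡hub       =
      hub-edge~spoke₀ 3∤p e∈G (subst₂ (Joins e) hi≡hub lo≡rim (Joins-sym {e = e} (Joins-self e)))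
    ... | inj₂ (_ , lo≡rim) | inj₂ (_ , hi≡rim) =
      chord~spoke₀ 3∤p e∈G (subst₂ (Joins e) lo≡rim hi≡rim (Joins-self e))

    one-ic-colorable : ¬ 3 ∣ period → OneIcColorable G
    one-ic-colorable 3∤p =
      (spokeEdge 0 , spoke∈G 0) , λ _ _ e∈G e′∈G → ~-trans (edge~spoke₀ 3∤p e∈G) (~-sym (edge~spoke₀ 3∤p e′∈G))

-- The cone over a Hamiltonian graph is a wheel

module _ {n m} {G : Subgraph n} {H : SimpleGraph m} where

  cone⇒wheel : Hamiltonian H → IsoToCone G H → Σ (Wheel G) λ W → Wheel.period W ≡ n ∸ 1
  cone⇒wheel (v , rest , cycle↭allFin , 3≤length , linked) (φ , G≅CH) = wheel , period≡n∸1
    where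
    open Inverse φ using (to; from; strictlyInverseˡ; strictlyInverseʳ)

    cone-edge : ∀ {x y} → ConeAdj H x y → GAdj G (from x) (from y)
    cone-edge {x} {y} adj = Equivalence.from (G≅CH (from x) (from y))
      (subst₂ (ConeAdj H) (≡.sym (strictlyInverseˡ x)) (≡.sym (strictlyInverseˡ y)) adj)

    from-injective : ∀ {x y} → from x ≡ from y → x ≡ y
    from-injective = Injection.injective (↔⇒↣ (↔-sym φ))

    cycle : ℕ → Fin m
    cycle = cycleAt v rest

    rim : ℕ → Fin n
    rim i = from (Fin.suc (cycle i))

    cycle-unique : Unique (v ∷ rest)
    cycle-unique = Permutationₛ.Unique-resp-↭ (setoid (Fin m)) (↭⇒↭ₛ (↭-sym cycle↭allFin)) (allFin⁺ m)

    hub-or-rim : ∀ u → u ≡ from Fin.zero ⊎ ∃[ i ] u ≡ rim i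
    hub-or-rim u with to u in to-u≡
    ... | Fin.zero  = inj₁ (≡.trans (≡.sym (strictlyInverseʳ u)) (cong from to-u≡))
    ... | Fin.suc x with cycleAt-surjective (∈-resp-↭ (↭-sym cycle↭allFin) (∈-allFin x))
    ...   | i , refl = inj₂ (i , ≡.trans (≡.sym (strictlyInverseʳ u)) (cong from to-u≡))

    wheel : Wheel G
    wheel = record
      { period       = length (v ∷ rest)
      ; hub          = from Fin.zero
      ; rim          = rim
      ; rim-periodic = cong (from ∘ Fin.suc) ∘ cycleAt-periodic v rest
      ; spoke        = λ i → cone-edge {Fin.zero} {Fin.suc (cycle i)} _
      ; rim-adj      = λ i → cone-edge {Fin.suc (cycle i)} {Fin.suc (cycle (suc i))} (cycleAt-linked linked i)
      ; rim-≢-2+     = λ i → cycleAt-≢-2+ cycle-unique 3≤length i ∘ suc-injective ∘ from-injective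
      ; hub-or-rim   = hub-or-rim
      }

    period≡n∸1 : length (v ∷ rest) ≡ n ∸ 1
    period≡n∸1 = begin
      length (v ∷ rest)  ≡⟨ ↭-length cycle↭allFin ⟩
      length (allFin m)  ≡⟨ length-tabulate id ⟩
      m                  ≡⟨ cong (_∸ 1) n≡1+m ⟨
      n ∸ 1              ∎
      where
      open ≡-Reasoning
      n≡1+m : n ≡ suc m
      n≡1+m = cantor-schröder-bernstein (Injection.injective (↔⇒↣ φ)) from-injective

theorem4p10 : (n : ℕ) → 5 ≤ n → ¬ (3 ∣ n ∸ 1) →
    (G : Subgraph n) → ((e : Edge n) → G e → kind e ≡ plus) →
    (∃[ m ] ∃[ H ] (Hamiltonian {m} H × IsoToCone G H)) →
    Bypassing G × OneIcColorable G
theorem4p10 n _ 3∤n∸1 G G⊆K⁺ (_ , _ , hamiltonian , G≅CH) with cone⇒wheel hamiltonian G≅CH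
... | wheel , period≡n∸1 =
  common-neighbours⇒bypassing G⊆K⁺ (common-neighbours wheel) ,
  one-ic-colorable wheel G⊆K⁺ (3∤n∸1 ∘ subst (3 ∣_) period≡n∸1)
  where open WheelProperties
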